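{- Let $A$ be a finite alphabet with $|A| = a$, let $n$ be a positive integer, and let $w$ be a pseudocyclic universal partial word for $A^n$ with diamondicity $d$. Let $f$ be the first window frame of $w$, and let $i$ be the length of the shortest word $f'$ such that $f = (f')^s$ for some positive integer $s$. Then $i$ divides $\gcd(a^{n-d}, n)$.
   Context: A partial word over $A$ is a finite sequence of characters from $A \cup \{\diamond\}$, where $\diamond \notin A$ is a wild-card symbol; a word over $A$ contains no $\diamond$. $A^n$ denotes the set of words of length $n$ over $A$. For $x = x_1\cdots x_n \in A^n$ and a partial word $w = w_1\cdots w_N$, the position $i$ ($0 \le i \le N-n$) covers $x$ if $x_j = w_{i+j}$ for every $1\le j\le n$ with $w_{i+j}\in A$. A universal partial word for $A^n$ is a partial word $w$ such that every word in $A^n$ is covered by exactly one position of $w$. A window is a string of $n$ consecutive characters of $w$; the frame of a partial word is obtained by replacing each letter of $A$ by the symbol $\_$, and the first window frame is the frame of $w_1\cdots w_n$. $w$ is pseudocyclic if its first $n-1$ characters equal its last $n-1$ characters as strings over $A\cup\{\diamond\}$ (possibly overlapping). For pseudocyclic universal partial words every window contains the same number $d$ of $\diamond$'s, called the diamondicity. $(f')^s$ denotes the concatenation of $s$ copies of $f'$. -}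

module Defs where

open import Data.Nat using (ℕ; zero; suc; _+_; _∸_; _≤_; _<_)
open import Data.Fin using (Fin)
open import Data.Maybe using (Maybe; just; nothing)
open import Data.List using (List; []; _∷_; length; take; drop; map; concat; replicate; filter)
open import Data.List.Relation.Binary.Pointwise using (Pointwise)
open import Data.Vec using (Vec; toList)
open import Data.Product using (Σ; ∃; _×_; _,_)
open import Data.Unit using (⊤)
open import Relation.Binary.PropositionalEquality using (_≡_)

-- A partial character over the alphabet A = Fin a: `just c` is the letter c,
-- `nothing` is the wild-card symbol ◇.
PChar : ℕ → Set
PChar a = Maybe (Fin a)

◇ : ∀ {a} → PChar a
◇ = nothing

PWord : ℕ → Set
PWord a = List (PChar a)

Compat : ∀ {a} → PChar a → Fin a → Set
Compat (just c) y = c ≡ y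
Compat nothing  y = ⊤

window : ∀ {a} → ℕ → ℕ → PWord a → PWord a
window n i w = take n (drop i w)

Covers : ∀ {a n} → PWord a → ℕ → Vec (Fin a) n → Set
Covers {n = n} w i x = (i + n ≤ length w) × Pointwise Compat (window n i w) (toList x)

UniquelyCovered : ∀ {a n} → PWord a → Vec (Fin a) n → Set
UniquelyCovered w x =
  Σ ℕ (λ i → Covers w i x × (∀ j → Covers w j x → j ≡ i))

Universal : (a n : ℕ) → PWord a → Set
Universal a n w = (x : Vec (Fin a) n) → UniquelyCovered w x

Pseudocyclic : ∀ {a} → ℕ → PWord a → Set
Pseudocyclic n w = take (n ∸ 1) w ≡ drop (length w ∸ (n ∸ 1)) w

diamonds : ∀ {a} → PWord a → ℕ
diamonds []              = zero
diamonds (nothing ∷ w)   = suc (diamonds w)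
diamonds (just _ ∷ w)    = diamonds w

HasDiamondicity : ∀ {a} → ℕ → PWord a → ℕ → Set
HasDiamondicity n w d = ∀ i → i + n ≤ length w → diamonds (window n i w) ≡ d

-- Frame symbols: ▭ stands for "_" (a letter), ◆ for ◇.
data FSym : Set where
  ▭ ◆ : FSym

frameChar : ∀ {a} → PChar a → FSym
frameChar (just _) = ▭
frameChar nothing  = ◆

frame : ∀ {a} → PWord a → List FSym
frame = map frameChar

firstWindowFrame : ∀ {a} → ℕ → PWord a → List FSym
firstWindowFrame n w = frame (take n w)

_^^_ : List FSym → ℕ → List FSym
f′ ^^ s = concat (replicate s f′)

IsRoot : List FSym → List FSym → Set
IsRoot f f′ = Σ ℕ (λ s → (1 ≤ s) × (f ≡ f′ ^^ s))

IsShortestRootLength : List FSym → ℕ → Set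
IsShortestRootLength f i =
  Σ (List FSym) (λ f′ → IsRoot f f′ × (length f′ ≡ i))
  × (∀ f′ → IsRoot f f′ → i ≤ length f′)

-- A word of A^n is determined by the unique position covering it (there are P = N − n + 1
-- of them) together with the d letters it puts under that window's ◇'s, so a^n = P · a^d
-- and P = a^(n−d).  Consecutive windows contain equally many ◇'s, so the frame of w is
-- n-periodic and therefore agrees, along its whole length, with the i-periodic extension
-- of f'.  Pseudocyclicity makes that extension also P-periodic, hence gcd(i, P)-periodic,
-- so the first window frame is a power of a word of length gcd(i, P); minimality of i gives
-- i = gcd(i, P) ∣ a^(n−d), and i ∣ n because f = (f')^s.  Over the empty alphabet every
-- frame consists of ◇'s and i = 1.

module Submission where

open import Defs
open import Algebra.Properties.CommutativeSemigroup using (xy∙z≈xz∙y)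
open import Data.Fin using (Fin; toℕ; fromℕ<)
open import Data.Fin.Permutation using (↔⇒≡)
open import Data.Fin.Properties using (toℕ<n; toℕ-fromℕ<; fromℕ<-toℕ; *↔×)
open import Data.List using (List; []; _∷_; [_]; length; take; drop; _++_; _∷ʳ_)
open import Data.List.Properties using (length-++; length-drop; length-take; length-map; take-map; drop-map; take-take)
open import Data.List.Relation.Binary.Pointwise using (Pointwise; []; _∷_)
open import Data.Maybe using (just; nothing)
open import Data.Nat using (ℕ; zero; suc; _+_; _*_; _∸_; _^_; _⊓_; _≤_; _<_; s≤s; z≤n; NonZero; ≢-nonZero; >-nonZero⁻¹; _%_; _/_)
open import Data.Nat.DivMod using (m<n⇒m%n≡m; [m+n]%n≡m%n; m≡m%n+[m/n]*n; m%n<n)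
open import Data.Nat.Divisibility using (_∣_; divides; ∣-trans; quotient; quotient≢0; ∣⇒≤; 1∣_)
open import Data.Nat.GCD using (gcd; gcd-GCD; gcd[m,n]∣m; gcd[m,n]∣n; gcd[m,n]≢0; gcd-greatest; module Bézout)
open import Data.Nat.Induction using (<-rec)
open import Data.Nat.Properties
open import Data.Product using (Σ; _×_; _,_)
open import Data.Product.Function.NonDependent.Propositional using (_×-↔_)
open import Data.Sum using (inj₁; inj₂)
open import Data.Unit using (tt)
open import Data.Vec using (Vec; []; _∷_; toList; cast)
open import Data.Vec.Properties using (cast-is-id; cast-trans)
open import Function.Bundles using (_↔_; mk↔ₛ′)
open import Function.Construct.Composition using (_↔-∘_)
open import Function.Construct.Identity using (↔-id)
open import Function.Properties.Inverse using (↔-sym)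
open import Relation.Binary.PropositionalEquality hiding ([_])
open import Relation.Nullary using (yes; no)
open ≡-Reasoning

-- Counting words by their covering positions

module _ {a : ℕ} where

  holes : ∀ {p : PWord a} {xs : List (Fin a)} → Pointwise Compat p xs → Vec (Fin a) (diamonds p)
  holes {nothing ∷ _} {y ∷ _} (_ ∷ pw) = y ∷ holes pw
  holes {just _  ∷ _}         (_ ∷ pw) = holes pw
  holes                       []       = []

  fill : ∀ (p : PWord a) → Vec (Fin a) (diamonds p) → ∀ {m} → length p ≡ m → Vec (Fin a) m
  fill []            v       {zero}  _ = []
  fill (nothing ∷ p) (y ∷ v) {suc m} e = y ∷ fill p v (suc-injective e)
  fill (just c  ∷ p) v       {suc m} e = c ∷ fill p v (suc-injective e)

  fill-compatible : ∀ p v {m} (e : length p ≡ m) → Pointwise Compat p (toList (fill p v e))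
  fill-compatible []            v       {zero}  _ = []
  fill-compatible (nothing ∷ p) (y ∷ v) {suc m} e = tt ∷ fill-compatible p v _
  fill-compatible (just c  ∷ p) v       {suc m} e = refl ∷ fill-compatible p v _

  holes-fill : ∀ p v {m} (e : length p ≡ m) (pw : Pointwise Compat p (toList (fill p v e))) → holes pw ≡ v
  holes-fill []            []      {zero}  _ []       = refl
  holes-fill (nothing ∷ p) (y ∷ v) {suc m} e (_ ∷ pw) = cong (y ∷_) (holes-fill p v _ pw)
  holes-fill (just c  ∷ p) v       {suc m} e (_ ∷ pw) = holes-fill p v _ pw

  fill-holes : ∀ p {m} (x : Vec (Fin a) m) (pw : Pointwise Compat p (toList x)) (e : length p ≡ m) →
               fill p (holes pw) e ≡ x
  fill-holes []            {zero}  []      []          _ = refl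
  fill-holes (nothing ∷ p) {suc m} (y ∷ x) (_ ∷ pw)    e = cong (y ∷_) (fill-holes p x pw _)
  fill-holes (just c  ∷ p) {suc m} (y ∷ x) (refl ∷ pw) e = cong (c ∷_) (fill-holes p x pw _)

Vec↔Fin^ : ∀ a k → Vec (Fin a) k ↔ Fin (a ^ k)
Vec↔Fin^ a zero    = mk↔ₛ′ (λ _ → Fin.zero) (λ _ → []) (λ { Fin.zero → refl ; (Fin.suc ()) }) (λ { [] → refl })
  where import Data.Fin as Fin
Vec↔Fin^ a (suc k) = ↔-sym (*↔× {a} {a ^ k}) ↔-∘ ((↔-id (Fin a) ×-↔ Vec↔Fin^ a k) ↔-∘ uncons)
  where
  uncons : Vec (Fin a) (suc k) ↔ (Fin a × Vec (Fin a) k)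
  uncons = mk↔ₛ′ (λ { (y ∷ v) → y , v }) (λ (y , v) → y ∷ v) (λ _ → refl) (λ { (y ∷ v) → refl })

cast-cancel : ∀ {A : Set} {m k} .(e : m ≡ k) .(e′ : k ≡ m) (v : Vec A k) → cast e (cast e′ v) ≡ v
cast-cancel e e′ v = trans (cast-trans e′ e v) (cast-is-id _ v)

length-take-≤ : ∀ {A : Set} (L : List A) {k} → k ≤ length L → length (take k L) ≡ k
length-take-≤ L {k} k≤L = trans (length-take k L) (m≤n⇒m⊓n≡m k≤L)

length-window : ∀ {a n j} (w : PWord a) → j + n ≤ length w → length (window n j w) ≡ n
length-window {n = n} {j} w j+n≤N =
  length-take-≤ (drop j w) (subst (n ≤_) (sym (length-drop j w)) (m+n≤o⇒m≤o∸n n (subst (_≤ length w) (+-comm j n) j+n≤N)))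

diamonds≤length : ∀ {a} (p : PWord a) → diamonds p ≤ length p
diamonds≤length []            = z≤n
diamonds≤length (nothing ∷ p) = s≤s (diamonds≤length p)
diamonds≤length (just _  ∷ p) = m≤n⇒m≤1+n (diamonds≤length p)

diamondicity≤length : ∀ {a n d} (w : PWord a) → HasDiamondicity n w d → n ≤ length w → d ≤ n
diamondicity≤length {n = n} w dd n≤N = subst₂ _≤_ (dd 0 n≤N) (length-window w n≤N) (diamonds≤length (window n 0 w))

a^m≡x*a^d⇒x≡a^[m∸d] : ∀ a {m d x} .{{_ : NonZero a}} → d ≤ m → a ^ m ≡ x * a ^ d → x ≡ a ^ (m ∸ d)
a^m≡x*a^d⇒x≡a^[m∸d] a {m} {d} {x} d≤m a^m≡x*a^d = *-cancelʳ-≡ x (a ^ (m ∸ d)) (a ^ d) {{m^n≢0 a d}} (begin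
  x * a ^ d            ≡⟨ sym a^m≡x*a^d ⟩
  a ^ m                ≡⟨ cong (a ^_) (sym (m∸n+n≡m d≤m)) ⟩
  a ^ (m ∸ d + d)      ≡⟨ ^-distribˡ-+-* a (m ∸ d) d ⟩
  a ^ (m ∸ d) * a ^ d  ∎)

module _ {a n q : ℕ} {w : PWord a} (N≡q+n : q + n ≡ length w) where

  private
    position< : ∀ {j} → j + n ≤ length w → j < suc q
    position< {j} j+n≤N = s≤s (+-cancelʳ-≤ n j q (subst (j + n ≤_) (sym N≡q+n) j+n≤N))

    position≤ : ∀ {j} → j < suc q → j + n ≤ length w
    position≤ {j} (s≤s j≤q) = subst (j + n ≤_) N≡q+n (+-monoˡ-≤ n j≤q)

  module _ (universal : Universal a n w) {d : ℕ} (dd : HasDiamondicity n w d) where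

    private
      locate : Vec (Fin a) n → Fin (suc q) × Vec (Fin a) d
      locate x = let (j , (j+n≤N , pw) , _) = universal x in
                 fromℕ< (position< j+n≤N) , cast (dd j j+n≤N) (holes pw)

      place : Fin (suc q) × Vec (Fin a) d → Vec (Fin a) n
      place (j , v) = let j+n≤N = position≤ (toℕ<n j) in
                      fill (window n (toℕ j) w) (cast (sym (dd (toℕ j) j+n≤N)) v) (length-window w j+n≤N)

      place-locate : ∀ x → place (locate x) ≡ x
      place-locate x with universal x
      ... | j , (j+n≤N , pw) , _ = fill-at (toℕ-fromℕ< (position< j+n≤N))
        where
        -- toℕ (fromℕ< _) ≡ j holds only propositionally, hence the generalisation to j′.
        fill-at : ∀ {j′} → j′ ≡ j → ∀ .{e : diamonds (window n j w) ≡ d} .{e′ : d ≡ diamonds (window n j′ w)}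
                  {ℓ : length (window n j′ w) ≡ n} →
                  fill (window n j′ w) (cast e′ (cast e (holes pw))) ℓ ≡ x
        fill-at refl {ℓ = ℓ} = trans (cong (λ v → fill (window n j w) v ℓ) (cast-cancel _ _ (holes pw)))
                                     (fill-holes (window n j w) x pw ℓ)

      locate-place : ∀ y → locate (place y) ≡ y
      locate-place (j , v) with universal (place (j , v))
      ... | _ , (_ , pw) , unique
        with unique (toℕ j) (position≤ (toℕ<n j) , fill-compatible (window n (toℕ j) w) _ _)
      ... | refl = cong₂ _,_ (fromℕ<-toℕ j _)
                     (trans (cong (cast _) (holes-fill (window n (toℕ j) w) _ _ pw)) (cast-cancel _ _ v))

    words↔positions×holes : Vec (Fin a) n ↔ (Fin (suc q) × Vec (Fin a) d)
    words↔positions×holes = mk↔ₛ′ locate place locate-place place-locate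

    a^n≡positions*a^d : a ^ n ≡ suc q * a ^ d
    a^n≡positions*a^d = ↔⇒≡ (↔-sym (*↔× {suc q} {a ^ d})
                          ↔-∘ ((↔-id (Fin (suc q)) ×-↔ Vec↔Fin^ a d)
                          ↔-∘ (words↔positions×holes
                          ↔-∘ ↔-sym (Vec↔Fin^ a n))))

-- Indexing and counting ◆'s in frames

infixl 9 _!_

-- Indexing past the end yields the junk value ▭.
_!_ : List FSym → ℕ → FSym
[]      ! _     = ▭
(x ∷ L) ! zero  = x
(x ∷ L) ! suc t = L ! t

!-take : ∀ L {k t} → t < k → take k L ! t ≡ L ! t
!-take []      {suc k} _         = refl
!-take (x ∷ L) {suc k} {zero}  _ = refl
!-take (x ∷ L) {suc k} {suc t} (s≤s t<k) = !-take L t<k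

!-drop : ∀ L k t → drop k L ! t ≡ L ! (k + t)
!-drop L       zero    t = refl
!-drop []      (suc k) t = refl
!-drop (x ∷ L) (suc k) t = !-drop L k t

!-++ˡ : ∀ L M {t} → t < length L → (L ++ M) ! t ≡ L ! t
!-++ˡ (x ∷ L) M {zero}  _         = refl
!-++ˡ (x ∷ L) M {suc t} (s≤s t<L) = !-++ˡ L M t<L

!-++ʳ : ∀ L M t → (L ++ M) ! (length L + t) ≡ M ! t
!-++ʳ []      M t = refl
!-++ʳ (x ∷ L) M t = !-++ʳ L M t

!-ext : ∀ L M → length L ≡ length M → (∀ t → t < length L → L ! t ≡ M ! t) → L ≡ M
!-ext []      []      _ _ = refl
!-ext (x ∷ L) (y ∷ M) e h =
  cong₂ _∷_ (h 0 (s≤s z≤n)) (!-ext L M (suc-injective e) (λ t t<L → h (suc t) (s≤s t<L)))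

drop-! : ∀ L {m} → m < length L → drop m L ≡ L ! m ∷ drop (suc m) L
drop-! (x ∷ L) {zero}  _         = refl
drop-! (x ∷ L) {suc m} (s≤s m<L) = drop-! L m<L

take-suc-! : ∀ L {n} → n < length L → take (suc n) L ≡ take n L ∷ʳ L ! n
take-suc-! (x ∷ L) {zero}  _         = refl
take-suc-! (x ∷ L) {suc n} (s≤s n<L) = cong (x ∷_) (take-suc-! L n<L)

◆-weight : FSym → ℕ
◆-weight ▭ = 0
◆-weight ◆ = 1

#◆ : List FSym → ℕ
#◆ []      = 0
#◆ (x ∷ L) = ◆-weight x + #◆ L

#◆-++ : ∀ L M → #◆ (L ++ M) ≡ #◆ L + #◆ M
#◆-++ []      M = refl
#◆-++ (x ∷ L) M = trans (cong (◆-weight x +_) (#◆-++ L M)) (sym (+-assoc (◆-weight x) (#◆ L) (#◆ M)))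

diamonds≡#◆-frame : ∀ {a} (p : PWord a) → diamonds p ≡ #◆ (frame p)
diamonds≡#◆-frame []            = refl
diamonds≡#◆-frame (nothing ∷ p) = cong suc (diamonds≡#◆-frame p)
diamonds≡#◆-frame (just _ ∷ p)  = diamonds≡#◆-frame p

◆-weight-injective : ∀ {x y} → ◆-weight x ≡ ◆-weight y → x ≡ y
◆-weight-injective {▭} {▭} _ = refl
◆-weight-injective {◆} {◆} _ = refl

#◆-∷ʳ : ∀ L y → #◆ (L ∷ʳ y) ≡ ◆-weight y + #◆ L
#◆-∷ʳ L y = begin
  #◆ (L ++ [ y ])          ≡⟨ #◆-++ L [ y ] ⟩
  #◆ L + (◆-weight y + 0)  ≡⟨ cong (#◆ L +_) (+-identityʳ (◆-weight y)) ⟩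
  #◆ L + ◆-weight y        ≡⟨ +-comm (#◆ L) (◆-weight y) ⟩
  ◆-weight y + #◆ L        ∎

#◆-∷-∷ʳ-cancel : ∀ {x y} L M → #◆ (x ∷ L) ≡ #◆ (M ∷ʳ y) → #◆ L ≡ #◆ M → x ≡ y
#◆-∷-∷ʳ-cancel {x} {y} L M xL≡My L≡M = ◆-weight-injective (+-cancelʳ-≡ (#◆ M) (◆-weight x) (◆-weight y) (begin
  ◆-weight x + #◆ M  ≡⟨ cong (◆-weight x +_) (sym L≡M) ⟩
  #◆ (x ∷ L)         ≡⟨ xL≡My ⟩
  #◆ (M ∷ʳ y)        ≡⟨ #◆-∷ʳ M y ⟩
  ◆-weight y + #◆ M  ∎))

equal-window-counts⇒periodic : ∀ L n d → (∀ m → m + n ≤ length L → #◆ (take n (drop m L)) ≡ d) →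
                               ∀ m → m + n < length L → L ! (m + n) ≡ L ! m
equal-window-counts⇒periodic L n d counts m m+n<L =
  sym (#◆-∷-∷ʳ-cancel (take n (drop (suc m) L)) (take n (drop m L))
        (cong #◆ (trans (sym first-split) last-split))
        (trans (counts (suc m) m+n<L) (sym (counts m (<⇒≤ m+n<L)))))
  where
  m<L : m < length L
  m<L = ≤-<-trans (m≤m+n m n) m+n<L
  n<L∸m : n < length (drop m L)
  n<L∸m = subst (n <_) (sym (length-drop m L)) (m+n≤o⇒m≤o∸n (suc n) (subst (_< length L) (+-comm m n) m+n<L))
  first-split : take (suc n) (drop m L) ≡ L ! m ∷ take n (drop (suc m) L)
  first-split = cong (take (suc n)) (drop-! L m<L)
  last-split : take (suc n) (drop m L) ≡ take n (drop m L) ∷ʳ L ! (m + n)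
  last-split = trans (take-suc-! (drop m L) n<L∸m) (cong (take n (drop m L) ∷ʳ_) (!-drop L m n))

-- Periodic functions on ℕ

Periodic : ∀ {A : Set} → (ℕ → A) → ℕ → Set
Periodic c p = ∀ x → c (x + p) ≡ c x

module _ {A : Set} {c : ℕ → A} where

  periodic-* : ∀ {p} → Periodic c p → ∀ k → Periodic c (k * p)
  periodic-* {p} per zero    x = cong c (+-identityʳ x)
  periodic-* {p} per (suc k) x = begin
    c (x + (p + k * p))  ≡⟨ cong c (sym (+-assoc x p (k * p))) ⟩
    c (x + p + k * p)    ≡⟨ periodic-* per k (x + p) ⟩
    c (x + p)            ≡⟨ per x ⟩
    c x                  ∎

  periodic-% : ∀ {p} .{{_ : NonZero p}} → Periodic c p → ∀ x → c x ≡ c (x % p)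
  periodic-% {p} per x = begin
    c x                    ≡⟨ cong c (m≡m%n+[m/n]*n x p) ⟩
    c (x % p + x / p * p)  ≡⟨ periodic-* per (x / p) (x % p) ⟩
    c (x % p)              ∎

  periodic-gcd : ∀ {p q} → Periodic c p → Periodic c q → Periodic c (gcd p q)
  periodic-gcd {p} {q} p-periodic q-periodic x with Bézout.identity (gcd-GCD p q)
  ... | Bézout.+- k l g+lq≡kp = begin
    c (x + gcd p q)            ≡⟨ sym (periodic-* q-periodic l (x + gcd p q)) ⟩
    c (x + gcd p q + l * q)    ≡⟨ cong c (trans (+-assoc x (gcd p q) (l * q)) (cong (x +_) g+lq≡kp)) ⟩
    c (x + k * p)              ≡⟨ periodic-* p-periodic k x ⟩
    c x                        ∎
  ... | Bézout.-+ k l g+kp≡lq = begin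
    c (x + gcd p q)            ≡⟨ sym (periodic-* p-periodic k (x + gcd p q)) ⟩
    c (x + gcd p q + k * p)    ≡⟨ cong c (trans (+-assoc x (gcd p q) (k * p)) (cong (x +_) g+kp≡lq)) ⟩
    c (x + l * q)              ≡⟨ periodic-* q-periodic l x ⟩
    c x                        ∎

  periodic-from-residues : ∀ {n p} .{{_ : NonZero n}} → Periodic c n →
                           (∀ r → r < n → c (r + p) ≡ c r) → Periodic c p
  periodic-from-residues {n} {p} n-periodic residues x = begin
    c (x + p)                  ≡⟨ cong (λ y → c (y + p)) (m≡m%n+[m/n]*n x n) ⟩
    c (x % n + x / n * n + p)  ≡⟨ cong c (xy∙z≈xz∙y +-commutativeSemigroup (x % n) (x / n * n) p) ⟩
    c (x % n + p + x / n * n)  ≡⟨ periodic-* n-periodic (x / n) (x % n + p) ⟩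
    c (x % n + p)              ≡⟨ residues (x % n) (m%n<n x n) ⟩
    c (x % n)                  ≡⟨ sym (periodic-% n-periodic x) ⟩
    c x                        ∎

periodic-mod : ∀ {A : Set} (h : ℕ → A) p .{{_ : NonZero p}} → Periodic (λ t → h (t % p)) p
periodic-mod h p x = cong h ([m+n]%n≡m%n x p)

length-^^ : ∀ L s → length (L ^^ s) ≡ s * length L
length-^^ L zero    = refl
length-^^ L (suc s) = trans (length-++ L) (cong (length L +_) (length-^^ L s))

root-nonZero : ∀ {f m} f′ s → length f ≡ suc m → f ≡ f′ ^^ s → NonZero (length f′)
root-nonZero f′ s f≡1+m refl = m*n≢0⇒n≢0 s {{subst NonZero (trans (sym f≡1+m) (length-^^ f′ s)) _}}

!-^^ : ∀ L s {p} .{{_ : NonZero p}} → length L ≡ p → ∀ {t} → t < s * p → (L ^^ s) ! t ≡ L ! (t % p)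
!-^^ L (suc s) refl {t} t<L+sL with t <? length L
... | yes t<L = trans (!-++ˡ L (L ^^ s) t<L) (cong (L !_) (sym (m<n⇒m%n≡m t<L)))
... | no t≮L = begin
  (L ++ L ^^ s) ! t               ≡⟨ cong ((L ++ L ^^ s) !_) (sym u+L≡t) ⟩
  (L ++ L ^^ s) ! (u + length L)  ≡⟨ cong ((L ++ L ^^ s) !_) (+-comm u (length L)) ⟩
  (L ++ L ^^ s) ! (length L + u)  ≡⟨ !-++ʳ L (L ^^ s) u ⟩
  (L ^^ s) ! u                    ≡⟨ !-^^ L s refl u<sL ⟩
  L ! (u % length L)              ≡⟨ cong (L !_) (sym ([m+n]%n≡m%n u (length L))) ⟩
  L ! ((u + length L) % length L) ≡⟨ cong (λ y → L ! (y % length L)) u+L≡t ⟩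
  L ! (t % length L)              ∎
  where
  u = t ∸ length L
  u+L≡t : u + length L ≡ t
  u+L≡t = m∸n+n≡m (≮⇒≥ t≮L)
  u<sL : u < s * length L
  u<sL = +-cancelʳ-< (length L) u (s * length L)
           (subst₂ _<_ (sym u+L≡t) (+-comm (length L) (s * length L)) t<L+sL)

agreement-extends : ∀ L (c : ℕ → FSym) n .{{_ : NonZero n}} → Periodic c n →
                    (∀ m → m + n < length L → L ! (m + n) ≡ L ! m) →
                    (∀ t → t < n → L ! t ≡ c t) → ∀ t → t < length L → L ! t ≡ c t
agreement-extends L c n n-periodic L-periodic initial = <-rec _ step
  where
  step : ∀ t → (∀ {m} → m < t → m < length L → L ! m ≡ c m) → t < length L → L ! t ≡ c t
  step t earlier t<L with t <? n
  ... | yes t<n = initial t t<n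
  ... | no t≮n = begin
    L ! t        ≡⟨ cong (L !_) (sym m+n≡t) ⟩
    L ! (m + n)  ≡⟨ L-periodic m (subst (_< length L) (sym m+n≡t) t<L) ⟩
    L ! m        ≡⟨ earlier m<t (<-trans m<t t<L) ⟩
    c m          ≡⟨ sym (n-periodic m) ⟩
    c (m + n)    ≡⟨ cong c m+n≡t ⟩
    c t          ∎
    where
    m = t ∸ n
    m+n≡t : m + n ≡ t
    m+n≡t = m∸n+n≡m (≮⇒≥ t≮n)
    m<t : m < t
    m<t = subst (m <_) m+n≡t (m<m+n m (>-nonZero⁻¹ n))

periodic-agreement⇒root : ∀ L (c : ℕ → FSym) g .{{_ : NonZero g}} .{{_ : NonZero (length L)}} →
                          Periodic c g → (∀ t → t < length L → L ! t ≡ c t) → g ∣ length L →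
                          IsRoot L (take g L)
periodic-agreement⇒root L c g g-periodic agree g∣L =
  k , >-nonZero⁻¹ k {{quotient≢0 g∣L}} ,
  !-ext L (take g L ^^ k) (trans L≡kg (sym (trans (length-^^ (take g L) k) (cong (k *_) length-root))))
    λ t t<L → begin
      L ! t                    ≡⟨ agree t t<L ⟩
      c t                      ≡⟨ periodic-% g-periodic t ⟩
      c (t % g)                ≡⟨ sym (agree (t % g) (<-≤-trans (m%n<n t g) (∣⇒≤ g∣L))) ⟩
      L ! (t % g)              ≡⟨ sym (!-take L (m%n<n t g)) ⟩
      take g L ! (t % g)       ≡⟨ sym (!-^^ (take g L) k length-root (subst (t <_) L≡kg t<L)) ⟩
      (take g L ^^ k) ! t      ∎
  where
  k = quotient g∣L
  L≡kg : length L ≡ k * g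
  L≡kg = _∣_.equality g∣L
  length-root : length (take g L) ≡ g
  length-root = length-take-≤ L (∣⇒≤ g∣L)

-- Frames of words with constant diamondicity

length-frame : ∀ {a} (w : PWord a) → length (frame w) ≡ length w
length-frame = length-map frameChar

length-firstWindowFrame : ∀ {a n} (w : PWord a) → n ≤ length w → length (firstWindowFrame n w) ≡ n
length-firstWindowFrame {n = n} w n≤N = trans (length-frame (take n w)) (length-take-≤ w n≤N)

frame-over-empty-alphabet : (w : PWord 0) → frame w ≡ (◆ ∷ []) ^^ length w
frame-over-empty-alphabet []            = refl
frame-over-empty-alphabet (nothing ∷ w) = cong (◆ ∷_) (frame-over-empty-alphabet w)

frame-window : ∀ {a} n m (w : PWord a) → take n (drop m (frame w)) ≡ frame (window n m w)
frame-window n m w = trans (cong (take n) (drop-map m w)) (take-map n (drop m w))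

frame-window-count : ∀ {a n d} (w : PWord a) → HasDiamondicity n w d →
                     ∀ m → m + n ≤ length (frame w) → #◆ (take n (drop m (frame w))) ≡ d
frame-window-count {n = n} {d} w dd m m+n≤N = begin
  #◆ (take n (drop m (frame w)))  ≡⟨ cong #◆ (frame-window n m w) ⟩
  #◆ (frame (window n m w))       ≡⟨ sym (diamonds≡#◆-frame (window n m w)) ⟩
  diamonds (window n m w)         ≡⟨ dd m (subst (m + n ≤_) (length-frame w) m+n≤N) ⟩
  d                               ∎

frame-periodic : ∀ {a n d} (w : PWord a) → HasDiamondicity n w d →
                 ∀ m → m + n < length (frame w) → frame w ! (m + n) ≡ frame w ! m
frame-periodic {n = n} {d} w dd = equal-window-counts⇒periodic (frame w) n d (frame-window-count w dd)

module _ {a n′ q : ℕ} {w : PWord a} (N≡q+n : q + suc n′ ≡ length w) (pc : Pseudocyclic (suc n′) w) where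

  private
    n = suc n′
    W = frame w

    N≡q+n′ : length W ≡ q + n
    N≡q+n′ = trans (length-frame w) (sym N≡q+n)

    n≤N : n ≤ length W
    n≤N = subst (n ≤_) (sym N≡q+n′) (m≤n+m n q)

    q<N : q < length W
    q<N = subst (q <_) (sym N≡q+n′) (m<m+n q (s≤s z≤n))

  pseudocyclic-frame : drop (suc q) W ≡ take n′ W
  pseudocyclic-frame = begin
    drop (suc q) W                   ≡⟨ drop-map (suc q) w ⟩
    frame (drop (suc q) w)           ≡⟨ cong (λ k → frame (drop k w)) (sym N∸n′≡1+q) ⟩
    frame (drop (length w ∸ n′) w)   ≡⟨ cong frame (sym pc) ⟩
    frame (take n′ w)                ≡⟨ sym (take-map n′ w) ⟩
    take n′ W                        ∎
    where
    N∸n′≡1+q : length w ∸ n′ ≡ suc q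
    N∸n′≡1+q = trans (cong (_∸ n′) (trans (sym N≡q+n) (+-suc q n′))) (m+n∸n≡m (suc q) n′)

  -- The last window is the first one rotated by one position.
  pseudocyclic-frame-wrap : ∀ {d} → HasDiamondicity n w d → W ! q ≡ W ! n′
  pseudocyclic-frame-wrap {d} dd =
    #◆-∷-∷ʳ-cancel (take n′ (drop (suc q) W)) (take n′ W)
      (begin
        #◆ (W ! q ∷ take n′ (drop (suc q) W))  ≡⟨ cong (λ L → #◆ (take n L)) (sym (drop-! W q<N)) ⟩
        #◆ (take n (drop q W))                 ≡⟨ frame-window-count w dd q (≤-reflexive (sym N≡q+n′)) ⟩
        d                                      ≡⟨ sym (frame-window-count w dd 0 n≤N) ⟩
        #◆ (take n W)                          ≡⟨ cong #◆ (take-suc-! W n≤N) ⟩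
        #◆ (take n′ W ∷ʳ W ! n′)               ∎)
      (cong #◆ (begin
        take n′ (drop (suc q) W)  ≡⟨ cong (take n′) pseudocyclic-frame ⟩
        take n′ (take n′ W)       ≡⟨ take-take n′ n′ W ⟩
        take (n′ ⊓ n′) W          ≡⟨ cong (λ k → take k W) (⊓-idem n′) ⟩
        take n′ W                 ∎))

  module _ {d : ℕ} (dd : HasDiamondicity (suc n′) w d)
           {f′ : List FSym} {s : ℕ} .{{_ : NonZero (length f′)}}
           (f≡f′^s : firstWindowFrame (suc n′) w ≡ f′ ^^ s) where

    private
      f = take n W
      i = length f′
      P = suc q

      cycle : ℕ → FSym
      cycle t = f′ ! (t % i)

      f≡ : f ≡ f′ ^^ s
      f≡ = trans (take-map n w) f≡f′^s

      length-f : length f ≡ n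
      length-f = length-take-≤ W n≤N

    n≡s*i : n ≡ s * i
    n≡s*i = trans (sym length-f) (trans (cong length f≡) (length-^^ f′ s))

    private
      cycle-periodic-n : Periodic cycle n
      cycle-periodic-n = subst (Periodic cycle) (sym n≡s*i) (periodic-* (periodic-mod (f′ !_) i) s)

      frame≈cycle : ∀ t → t < length W → W ! t ≡ cycle t
      frame≈cycle = agreement-extends W cycle n cycle-periodic-n (frame-periodic w dd) λ t t<n → begin
        W ! t          ≡⟨ sym (!-take W t<n) ⟩
        f ! t          ≡⟨ cong (_! t) f≡ ⟩
        (f′ ^^ s) ! t  ≡⟨ !-^^ f′ s refl (subst (t <_) n≡s*i t<n) ⟩
        cycle t        ∎

      cycle-periodic-P : Periodic cycle P
      cycle-periodic-P = periodic-from-residues cycle-periodic-n residues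
        where
        residues : ∀ r → r < n → cycle (r + P) ≡ cycle r
        residues r r<n with m<1+n⇒m<n∨m≡n r<n
        ... | inj₁ r<n′ = begin
          cycle (r + P)      ≡⟨ sym (frame≈cycle (r + P) r+P<N) ⟩
          W ! (r + P)        ≡⟨ cong (W !_) (+-comm r P) ⟩
          W ! (P + r)        ≡⟨ sym (!-drop W P r) ⟩
          drop P W ! r       ≡⟨ cong (_! r) pseudocyclic-frame ⟩
          take n′ W ! r      ≡⟨ !-take W r<n′ ⟩
          W ! r              ≡⟨ frame≈cycle r (<-trans r<n′ n≤N) ⟩
          cycle r            ∎
          where
          r+P<N : r + P < length W
          r+P<N = subst₂ _<_ (+-comm P r) (sym (trans N≡q+n′ (+-suc q n′))) (+-monoʳ-< P r<n′)
        ... | inj₂ refl = begin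
          cycle (n′ + P)     ≡⟨ cong cycle (trans (+-suc n′ q) (trans (cong suc (+-comm n′ q)) (sym (+-suc q n′)))) ⟩
          cycle (q + n)      ≡⟨ cycle-periodic-n q ⟩
          cycle q            ≡⟨ sym (frame≈cycle q q<N) ⟩
          W ! q              ≡⟨ pseudocyclic-frame-wrap dd ⟩
          W ! n′             ≡⟨ frame≈cycle n′ n≤N ⟩
          cycle n′           ∎

    private
      firstWindowFrame-gcd-root : Σ (List FSym) λ r → IsRoot (firstWindowFrame n w) r × length r ≡ gcd i P
      firstWindowFrame-gcd-root =
        take g f ,
        subst (λ L → IsRoot L (take g f)) (take-map n w)
          (periodic-agreement⇒root f cycle g (periodic-gcd (periodic-mod (f′ !_) i) cycle-periodic-P) f≈cycle g∣f) ,
        length-take-≤ f (∣⇒≤ g∣f)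
        where
        g = gcd i P
        instance
          g-nonZero : NonZero g
          g-nonZero = ≢-nonZero (gcd[m,n]≢0 i P (inj₂ λ ()))
          f-nonempty : NonZero (length f)
          f-nonempty = subst NonZero (sym length-f) _
        g∣f : g ∣ length f
        g∣f = subst (g ∣_) (sym length-f) (∣-trans (gcd[m,n]∣m i P) (divides s n≡s*i))
        f≈cycle : ∀ t → t < length f → f ! t ≡ cycle t
        f≈cycle t t<f = trans (!-take W t<n) (frame≈cycle t (<-≤-trans t<n n≤N))
          where
          t<n : t < n
          t<n = subst (t <_) length-f t<f

    shortest-root≡gcd : (∀ r → IsRoot (firstWindowFrame n w) r → i ≤ length r) → i ≡ gcd i P
    shortest-root≡gcd shortest with firstWindowFrame-gcd-root
    ... | r , r-root , r≡gcd = ≤-antisym (subst (i ≤_) r≡gcd (shortest r r-root)) (∣⇒≤ (gcd[m,n]∣m i P))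

theorem4p11 : (a n : ℕ) → 1 ≤ n → (w : PWord a) → n ≤ length w →
  Universal a n w → Pseudocyclic n w →
  (d : ℕ) → HasDiamondicity n w d →
  (i : ℕ) → IsShortestRootLength (firstWindowFrame n w) i →
  i ∣ gcd (a ^ (n ∸ d)) n
theorem4p11 zero (suc n′) _ w n≤N _ _ _ _ _ ((f′ , (s , _ , f≡f′^s) , refl) , shortest) =
  subst (_∣ _) (sym i≡1) (1∣ _)
  where
  ◆-root : IsRoot (firstWindowFrame (suc n′) w) (◆ ∷ [])
  ◆-root = suc n′ , s≤s z≤n ,
           trans (frame-over-empty-alphabet (take (suc n′) w)) (cong ((◆ ∷ []) ^^_) (length-take-≤ w n≤N))
  i≡1 : length f′ ≡ 1
  i≡1 = ≤-antisym (shortest (◆ ∷ []) ◆-root)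
                  (>-nonZero⁻¹ _ {{root-nonZero f′ s (length-firstWindowFrame w n≤N) f≡f′^s}})
theorem4p11 (suc a′) (suc n′) _ w n≤N universal pc d dd _ ((f′ , (s , _ , f≡f′^s) , refl) , shortest) =
  gcd-greatest (subst (i ∣_) P≡a^[n∸d] i∣P) (divides s (n≡s*i N≡q+n pc dd {f′} {s} f≡f′^s))
  where
  i = length f′
  q = length w ∸ suc n′
  N≡q+n : q + suc n′ ≡ length w
  N≡q+n = m∸n+n≡m n≤N
  instance
    i-nonZero : NonZero i
    i-nonZero = root-nonZero f′ s (length-firstWindowFrame w n≤N) f≡f′^s
  i∣P : i ∣ suc q
  i∣P = subst (_∣ suc q) (sym (shortest-root≡gcd N≡q+n pc dd {f′} {s} f≡f′^s shortest)) (gcd[m,n]∣n i (suc q))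
  P≡a^[n∸d] : suc q ≡ suc a′ ^ (suc n′ ∸ d)
  P≡a^[n∸d] = a^m≡x*a^d⇒x≡a^[m∸d] (suc a′) (diamondicity≤length w dd n≤N) (a^n≡positions*a^d N≡q+n universal dd)
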